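{- Let $p,q,k,n$ be positive integers with $\gcd(p+q,k)>p$, and let $0 \leq r \leq p$ be an integer. Let $b_1=k-r$ and $b_2=\ldots=b_n=k$. Then Avoider, as the second player, has a winning strategy in the game $mBox(b_1, \ldots, b_n,(p,q))$.
   Context: A $(p,q)$ Avoider-Enforcer game (strict rules): Avoider and Enforcer alternately claim exactly $p$ and exactly $q$ previously unclaimed board elements per move, respectively; a player facing fewer unclaimed elements than his bias claims all of them; the game ends when all elements are claimed; Avoider loses if at the end he has claimed all elements of some target set, otherwise he wins. $mBox(b_1,\ldots,b_n,(p,q))$ is this game on the disjoint union of pairwise disjoint boxes $B_1,\ldots,B_n$ with $|B_i|=b_i$, with target sets exactly $B_1,\ldots,B_n$. -}

module Defs where

open import Data.Nat using (ℕ; zero; suc; _+_; _<_; _⊓_)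
open import Data.Bool using (true; false)
open import Data.List using (List; []; _∷_; map)
open import Data.Nat.ListAction using (sum)
open import Data.List.Relation.Unary.All using (All)
open import Data.Vec using (Vec; replicate; _++_)
open import Data.Fin.Subset using (Subset; ⊥; ∁; _∪_; _⊆_; ∣_∣)
open import Relation.Binary.PropositionalEquality using (_≡_)
open import Relation.Nullary using (¬_)

data Player : Set where
  avoider enforcer : Player

free : ∀ {N} → Subset N → Subset N → Subset N
free A E = ∁ (A ∪ E)

-- Generic (p,q) Avoider-Enforcer game with strict rules on board Fin N
-- with a list of target sets.  `AvoiderWins p q F t A E` : Avoider has a
-- winning strategy from the position (A, E) with player t to move.
-- (Inductive, hence every play following the strategy is finite.)
-- A move claims exactly min(bias, #unclaimed) unclaimed elements; the game
-- ends when nothing is unclaimed; Avoider wins iff he has not claimed all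
-- elements of any target set.
data AvoiderWins {N : ℕ} (p q : ℕ) (F : List (Subset N))
     : Player → Subset N → Subset N → Set where
  finish : ∀ {t A E} → ∣ free A E ∣ ≡ 0 →
           All (λ T → ¬ (T ⊆ A)) F →
           AvoiderWins p q F t A E
  avoiderMove : ∀ {A E} → 0 < ∣ free A E ∣ →
           (m : Subset N) → m ⊆ free A E → ∣ m ∣ ≡ p ⊓ ∣ free A E ∣ →
           AvoiderWins p q F enforcer (A ∪ m) E →
           AvoiderWins p q F avoider A E
  enforcerMove : ∀ {A E} → 0 < ∣ free A E ∣ →
           ((m : Subset N) → m ⊆ free A E → ∣ m ∣ ≡ q ⊓ ∣ free A E ∣ →
             AvoiderWins p q F avoider A (E ∪ m)) →
           AvoiderWins p q F enforcer A E

-- The boxes B_1,...,B_n as consecutive blocks of the board Fin (b_1+...+b_n).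
boxes : (bs : List ℕ) → List (Subset (sum bs))
boxes [] = []
boxes (b ∷ bs) = (replicate b true ++ replicate (sum bs) false)
               ∷ map (λ S → replicate b false ++ S) (boxes bs)

AvoiderWinsMBoxSecond : List ℕ → ℕ → ℕ → Set
AvoiderWinsMBoxSecond bs p q = AvoiderWins p q (boxes bs) enforcer ⊥ ⊥

module Submission where

-- Let d = gcd(p + q, k), so p < d ≤ k and d ∣ k.
-- A box is blocked once Enforcer owns a cell of it that Avoider lacks; its
-- unclaimed cells are then safe for Avoider.  Avoider maintains: (i) each
-- unblocked box has k - δ unclaimed cells, the deficits δ summing to D ≤ r;
-- (ii) the number of unclaimed cells is ≡ -r (mod d) on Enforcer's turn and
-- ≡ -(r + q) on his own.  He claims p safe cells if he can; if no unblocked box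
-- is left he claims everything; otherwise (ii) forces (#safe cells) + (r - D)
-- = p and he claims all safe cells plus r - D cells of an unblocked box.  On a
-- full board, D < k makes every box blocked, so Avoider owns no whole box.

open import Defs
open import Data.Nat using (ℕ; suc; _<_; _≤_; _+_; _∸_)
open import Data.Nat.GCD using (gcd)
open import Data.List using (_∷_; replicate)

open import Data.Nat using (zero; _*_; _⊓_; z≤n; s≤s⁻¹; _≟_; _≤?_; NonZero; >-nonZero)
open import Data.Nat.Properties
open import Data.Nat.Tactic.RingSolver using (solve-∀)
open import Algebra.Properties.CommutativeSemigroup +-commutativeSemigroup
  using (interchange; xy∙z≈xz∙y; x∙yz≈y∙xz)
open import Data.Nat.Divisibility using (_∣_; ∣m+n∣m⇒∣n; ∣m∣n⇒∣m+n; ∣n⇒∣m*n; ∣⇒≤; _∣0)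
open import Data.Nat.GCD using (gcd[m,n]∣m; gcd[m,n]∣n)
open import Data.Nat.ListAction using (sum)
open import Data.Bool using (true; false; _∨_; not)
open import Data.List using (List; [])
open import Data.List.Relation.Unary.All as All using (All; []; _∷_)
open import Data.List.Relation.Unary.All.Properties using (map⁺)
open import Data.Vec using ([]; _∷_; _++_; splitAt)
open import Data.Vec.Properties using (zipWith-++; map-++)
open import Data.Fin using (zero)
open import Data.Fin.Subset using (Subset; ⊥; ⊤; ∁; _∪_; _⊆_; ∣_∣; _∈_; _∉_; Nonempty)
open import Data.Fin.Subset.Properties
  using (drop-∷-⊆; out⊆; in⊆in; ⊆-refl; ⊆-trans; ⊥⊆; ∣⊥∣≡0; ∈⊤; p⊆q⇒∣p∣≤∣q∣; ∪-assoc; ∪-comm;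
         x∈p∪q⁺; x∈p∪q⁻; x∈∁p⇒x∉p; nonempty?; Empty-unique)
open import Data.Vec.Base using (here; there)
open import Data.Product using (∃-syntax; _×_; _,_; proj₁; proj₂)
open import Data.Sum using (inj₁; inj₂; [_,_])
open import Function using (_∘_)
open import Relation.Nullary using (¬_; yes; no; contradiction)
open import Relation.Binary.Definitions using (tri<; tri≈; tri>)
open import Relation.Binary.PropositionalEquality
  using (_≡_; refl; sym; trans; cong; cong₂; subst; subst₂; module ≡-Reasoning)

congruent-apart : ∀ {d x y} c → d ∣ x + c → d ∣ y + c → x < y → x + d ≤ y
congruent-apart {d} {x} {y} c d∣x+c d∣y+c x<y = begin
    x + d       ≤⟨ +-monoʳ-≤ x d≤y∸x ⟩
    x + (y ∸ x) ≡⟨ m+[n∸m]≡n (<⇒≤ x<y) ⟩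
    y           ∎
  where
  open ≤-Reasoning
  instance
    nonzero : NonZero (y ∸ x)
    nonzero = >-nonZero (m<n⇒0<n∸m x<y)
  regroup : x + c + (y ∸ x) ≡ y + c
  regroup = trans (xy∙z≈xz∙y x c (y ∸ x)) (cong (_+ c) (m+[n∸m]≡n (<⇒≤ x<y)))
  d≤y∸x : d ≤ y ∸ x
  d≤y∸x = ∣⇒≤ (∣m+n∣m⇒∣n (subst (d ∣_) (sym regroup) d∣y+c) d∣x+c)

congruent-close : ∀ {d a b} c → d ∣ a + c → d ∣ b + c → a < b + d → b < a + d → a ≡ b
congruent-close {d} {a} {b} c d∣a+c d∣b+c a<b+d b<a+d with <-cmp a b
... | tri< a<b _ _ = contradiction (congruent-apart c d∣a+c d∣b+c a<b) (<⇒≱ b<a+d)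
... | tri≈ _ a≡b _ = a≡b
... | tri> _ _ b<a = contradiction (congruent-apart c d∣b+c d∣a+c b<a) (<⇒≱ a<b+d)

claim-shrinks : ∀ {b n n' c} → 0 < b → 0 < n → c ≡ b ⊓ n → n' + c ≡ n → n' < n
claim-shrinks {n' = n'} 0<b 0<n refl n'+c≡n =
  subst (n' <_) n'+c≡n (m<m+n n' (⊓-pres-m< 0<b 0<n))

claim-full : ∀ {b n n' c} → c ≡ b ⊓ n → n' + c ≡ n → 0 < n' → c ≡ b
claim-full {b} {n} {c = c} refl n'+c≡n 0<n' with ⊓-sel b n
... | inj₁ b⊓n≡b = b⊓n≡b
... | inj₂ b⊓n≡n = contradiction b⊓n≡n (<⇒≢ c<n)
  where
  c<n : c < n
  c<n = subst (c <_) n'+c≡n (m<n+m c 0<n')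

zero-∈ : ∀ {m n x} {p : Subset m} {q : Subset n} → zero ∈ x ∷ p → zero ∈ x ∷ q
zero-∈ here = here

∣++∣ : ∀ {m n} (a : Subset m) (b : Subset n) → ∣ a ++ b ∣ ≡ ∣ a ∣ + ∣ b ∣
∣++∣ []          b = refl
∣++∣ (true ∷ a)  b = cong suc (∣++∣ a b)
∣++∣ (false ∷ a) b = ∣++∣ a b

∣⊥++∣ : ∀ m {n} (b : Subset n) → ∣ ⊥ {m} ++ b ∣ ≡ ∣ b ∣
∣⊥++∣ m b = trans (∣++∣ (⊥ {m}) b) (cong (_+ ∣ b ∣) (∣⊥∣≡0 m))

⊥-++ : ∀ m n → ⊥ {m + n} ≡ ⊥ {m} ++ ⊥ {n}
⊥-++ zero    n = refl
⊥-++ (suc m) n = cong (false ∷_) (⊥-++ m n)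

∣free-⊥⊥∣ : ∀ n → ∣ free (⊥ {n}) ⊥ ∣ ≡ n
∣free-⊥⊥∣ zero    = refl
∣free-⊥⊥∣ (suc n) = cong suc (∣free-⊥⊥∣ n)

∪-++ : ∀ {m n} (a c : Subset m) (b d : Subset n) → (a ++ b) ∪ (c ++ d) ≡ (a ∪ c) ++ (b ∪ d)
∪-++ a c b d = zipWith-++ _∨_ a b c d

free-++ : ∀ {m n} (A₀ E₀ : Subset m) (A E : Subset n) →
          free (A₀ ++ A) (E₀ ++ E) ≡ free A₀ E₀ ++ free A E
free-++ A₀ E₀ A E = trans (cong ∁ (∪-++ A₀ E₀ A E)) (map-++ not (A₀ ∪ E₀) (A ∪ E))

∣free-++∣ : ∀ {m n} (A₀ E₀ : Subset m) (A E : Subset n) →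
            ∣ free (A₀ ++ A) (E₀ ++ E) ∣ ≡ ∣ free A₀ E₀ ∣ + ∣ free A E ∣
∣free-++∣ A₀ E₀ A E = trans (cong ∣_∣ (free-++ A₀ E₀ A E)) (∣++∣ (free A₀ E₀) (free A E))

++-⊆ : ∀ {m n} {a c : Subset m} {b d : Subset n} → a ⊆ c → b ⊆ d → a ++ b ⊆ c ++ d
++-⊆ {a = []}    {[]}    _   b⊆d = b⊆d
++-⊆ {a = _ ∷ _} {_ ∷ _} a⊆c b⊆d here      = zero-∈ (a⊆c here)
++-⊆ {a = _ ∷ _} {_ ∷ _} a⊆c b⊆d (there i) = there (++-⊆ (drop-∷-⊆ a⊆c) b⊆d i)

⊆-++⁻ : ∀ {m n} (a c : Subset m) {b d : Subset n} → a ++ b ⊆ c ++ d → a ⊆ c × b ⊆ d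
⊆-++⁻ []      []      ab⊆cd = (λ ()) , ab⊆cd
⊆-++⁻ (x ∷ a) (y ∷ c) ab⊆cd with ⊆-++⁻ a c (drop-∷-⊆ ab⊆cd)
... | a⊆c , b⊆d = head-and-tail , b⊆d
  where
  head-and-tail : x ∷ a ⊆ y ∷ c
  head-and-tail here      = zero-∈ (ab⊆cd here)
  head-and-tail (there i) = there (a⊆c i)

⊆-free-++ : ∀ {m n} (A₀ E₀ : Subset m) (A E : Subset n) {a : Subset (m + n)} →
            a ⊆ free A₀ E₀ ++ free A E → a ⊆ free (A₀ ++ A) (E₀ ++ E)
⊆-free-++ A₀ E₀ A E = subst (_ ⊆_) (sym (free-++ A₀ E₀ A E))

⊆-free-++⁻ : ∀ {m n} (A₀ E₀ : Subset m) (A E : Subset n) (m₀ : Subset m) {m₁ : Subset n} →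
             m₀ ++ m₁ ⊆ free (A₀ ++ A) (E₀ ++ E) → m₀ ⊆ free A₀ E₀ × m₁ ⊆ free A E
⊆-free-++⁻ A₀ E₀ A E m₀ h = ⊆-++⁻ m₀ (free A₀ E₀) (subst (_ ⊆_) (free-++ A₀ E₀ A E) h)

∣∁-∪∣ : ∀ {n} (X m : Subset n) → m ⊆ ∁ X → ∣ ∁ (X ∪ m) ∣ + ∣ m ∣ ≡ ∣ ∁ X ∣
∣∁-∪∣ []          []          _ = refl
∣∁-∪∣ (false ∷ X) (false ∷ m) m⊆ = cong suc (∣∁-∪∣ X m (drop-∷-⊆ m⊆))
∣∁-∪∣ (true ∷ X)  (false ∷ m) m⊆ = ∣∁-∪∣ X m (drop-∷-⊆ m⊆)
∣∁-∪∣ (false ∷ X) (true ∷ m)  m⊆ = trans (+-suc _ _) (cong suc (∣∁-∪∣ X m (drop-∷-⊆ m⊆)))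
∣∁-∪∣ (true ∷ X)  (true ∷ m)  m⊆ with m⊆ here
... | ()

claim-avoider : ∀ {n} {A E m : Subset n} → m ⊆ free A E → ∣ free (A ∪ m) E ∣ + ∣ m ∣ ≡ ∣ free A E ∣
claim-avoider {A = A} {E} {m} m⊆ =
  subst (λ Y → ∣ ∁ Y ∣ + ∣ m ∣ ≡ ∣ free A E ∣) regroup (∣∁-∪∣ (A ∪ E) m m⊆)
  where
  regroup : (A ∪ E) ∪ m ≡ (A ∪ m) ∪ E
  regroup = begin
    (A ∪ E) ∪ m ≡⟨ ∪-assoc A E m ⟩
    A ∪ (E ∪ m) ≡⟨ cong (A ∪_) (∪-comm E m) ⟩
    A ∪ (m ∪ E) ≡⟨ ∪-assoc A m E ⟨
    (A ∪ m) ∪ E ∎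
    where open ≡-Reasoning

claim-enforcer : ∀ {n} {A E m : Subset n} → m ⊆ free A E → ∣ free A (E ∪ m) ∣ + ∣ m ∣ ≡ ∣ free A E ∣
claim-enforcer {A = A} {E} {m} m⊆ =
  subst (λ Y → ∣ ∁ Y ∣ + ∣ m ∣ ≡ ∣ free A E ∣) (∪-assoc A E m) (∣∁-∪∣ (A ∪ E) m m⊆)

claim-nothing : ∀ {n' c n} → n' + c ≡ n → c ≡ 0 → n' ≡ n
claim-nothing {n'} refl refl = sym (+-identityʳ n')

choose : ∀ {n} (X : Subset n) c → c ≤ ∣ X ∣ → ∃[ m ] m ⊆ X × ∣ m ∣ ≡ c
choose []          zero    _ = [] , (λ ()) , refl
choose (false ∷ X) c       c≤ with choose X c c≤
... | m , m⊆X , ∣m∣≡c = false ∷ m , out⊆ m⊆X , ∣m∣≡c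
choose {suc n} (true ∷ X) zero _ = ⊥ , ⊥⊆ , ∣⊥∣≡0 (suc n)
choose (true ∷ X)  (suc c) c≤ with choose X c (s≤s⁻¹ c≤)
... | m , m⊆X , ∣m∣≡c = true ∷ m , in⊆in m⊆X , cong suc ∣m∣≡c

nonempty : ∀ {n} {p : Subset n} → 0 < ∣ p ∣ → Nonempty p
nonempty {n} {p} 0<∣p∣ with nonempty? p
... | yes p≢∅ = p≢∅
... | no p≡∅ = contradiction (trans (cong ∣_∣ (Empty-unique p≡∅)) (∣⊥∣≡0 n)) (>⇒≢ 0<∣p∣)

Blocked : ∀ {n} → Subset n → Subset n → Set
Blocked A E = ∃[ x ] x ∈ E × x ∉ A

blocked-⊤ : ∀ {n} {A E : Subset n} → Blocked A E → ¬ (⊤ ⊆ A)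
blocked-⊤ (x , _ , x∉A) ⊤⊆A = x∉A (⊤⊆A ∈⊤)

block : ∀ {n} {A E m : Subset n} → m ⊆ free A E → 0 < ∣ m ∣ → Blocked A (E ∪ m)
block m⊆ 0<∣m∣ with nonempty 0<∣m∣
... | x , x∈m = x , x∈p∪q⁺ (inj₂ x∈m) , λ x∈A → x∈∁p⇒x∉p (m⊆ x∈m) (x∈p∪q⁺ (inj₁ x∈A))

blocked-avoider : ∀ {n} {A E m : Subset n} → m ⊆ free A E → Blocked A E → Blocked (A ∪ m) E
blocked-avoider {A = A} {m = m} m⊆ (x , x∈E , x∉A) = x , x∈E , x∉A∪m
  where
  x∉m : x ∉ m
  x∉m x∈m = x∈∁p⇒x∉p (m⊆ x∈m) (x∈p∪q⁺ (inj₂ x∈E))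
  x∉A∪m : x ∉ A ∪ m
  x∉A∪m = [ x∉A , x∉m ] ∘ x∈p∪q⁻ A m

blocked-enforcer : ∀ {n} {A E m : Subset n} → Blocked A E → Blocked A (E ∪ m)
blocked-enforcer (x , x∈E , x∉A) = x , x∈p∪q⁺ (inj₁ x∈E) , x∉A

-- Play
-- terminates because each move of positive bias claims at least one cell.
module FromInvariant {N} (p q : ℕ) (F : List (Subset N)) (0<p : 0 < p) (0<q : 0 < q)
  (I : Player → Subset N → Subset N → Set)
  (won : ∀ {t A E} → I t A E → ∣ free A E ∣ ≡ 0 → All (λ T → ¬ (T ⊆ A)) F)
  (enforcer-step : ∀ {A E} → I enforcer A E → (m : Subset N) → m ⊆ free A E →
                   ∣ m ∣ ≡ q ⊓ ∣ free A E ∣ → I avoider A (E ∪ m))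
  (avoider-step : ∀ {A E} → I avoider A E → 0 < ∣ free A E ∣ →
                  ∃[ m ] m ⊆ free A E × ∣ m ∣ ≡ p ⊓ ∣ free A E ∣ × I enforcer (A ∪ m) E)
  where

  play : ∀ bound {t A E} → ∣ free A E ∣ < bound → I t A E → AvoiderWins p q F t A E
  play zero () _
  play (suc bound) {A = A} {E} ∣free∣<bound i with ∣ free A E ∣ ≟ 0
  ... | yes over = finish over (won i over)
  play (suc bound) {avoider} {A} {E} ∣free∣<bound i | no ¬over with avoider-step i (n≢0⇒n>0 ¬over)
  ... | m , m⊆ , ∣m∣ , i' = avoiderMove 0<∣free∣ m m⊆ ∣m∣ (play bound fewer i')
    where
    0<∣free∣ : 0 < ∣ free A E ∣
    0<∣free∣ = n≢0⇒n>0 ¬over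
    fewer : ∣ free (A ∪ m) E ∣ < bound
    fewer = <-≤-trans (claim-shrinks 0<p 0<∣free∣ ∣m∣ (claim-avoider m⊆)) (s≤s⁻¹ ∣free∣<bound)
  play (suc bound) {enforcer} {A} {E} ∣free∣<bound i | no ¬over =
    enforcerMove 0<∣free∣ λ m m⊆ ∣m∣ →
      play bound (fewer m⊆ ∣m∣) (enforcer-step i m m⊆ ∣m∣)
    where
    0<∣free∣ : 0 < ∣ free A E ∣
    0<∣free∣ = n≢0⇒n>0 ¬over
    fewer : ∀ {m} → m ⊆ free A E → ∣ m ∣ ≡ q ⊓ ∣ free A E ∣ → ∣ free A (E ∪ m) ∣ < bound
    fewer m⊆ ∣m∣ = <-≤-trans (claim-shrinks 0<q 0<∣free∣ ∣m∣ (claim-enforcer m⊆)) (s≤s⁻¹ ∣free∣<bound)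

  avoider-wins : ∀ {t A E} → I t A E → AvoiderWins p q F t A E
  avoider-wins = play _ ≤-refl

-- A layout of a position on the boxes bs classifies every box as
-- blocked, or unblocked with k - δ unclaimed cells (its deficit δ); the index
-- D is the total deficit.  Unclaimed cells of blocked boxes are safe for
-- Avoider.
module Layouts (k : ℕ) where

  data Layout : (bs : List ℕ) → Subset (sum bs) → Subset (sum bs) → ℕ → Set where
    []        : Layout [] [] [] 0
    blocked   : ∀ {b bs D} {A₀ E₀ : Subset b} {A E : Subset (sum bs)} →
                Blocked A₀ E₀ → Layout bs A E D →
                Layout (b ∷ bs) (A₀ ++ A) (E₀ ++ E) D
    unblocked : ∀ {b bs D δ} {A₀ E₀ : Subset b} {A E : Subset (sum bs)} →
                ∣ free A₀ E₀ ∣ + δ ≡ k → Layout bs A E D →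
                Layout (b ∷ bs) (A₀ ++ A) (E₀ ++ E) (δ + D)

  safe : ∀ {bs A E D} → Layout bs A E D → Subset (sum bs)
  safe []                          = []
  safe (blocked {A₀ = A₀} {E₀} _ L) = free A₀ E₀ ++ safe L
  safe (unblocked {b} _ L)          = ⊥ {b} ++ safe L

  unblocked-boxes : ∀ {bs A E D} → Layout bs A E D → ℕ
  unblocked-boxes []              = 0
  unblocked-boxes (blocked _ L)   = unblocked-boxes L
  unblocked-boxes (unblocked _ L) = suc (unblocked-boxes L)

  unblocked-⊥ : ∀ {b bs δ D} → ∣ free (⊥ {b}) ⊥ ∣ + δ ≡ k → Layout bs ⊥ ⊥ D →
                Layout (b ∷ bs) ⊥ ⊥ (δ + D)
  unblocked-⊥ {b} {bs} count L =
    subst₂ (λ A E → Layout (b ∷ bs) A E _) ⊥≡ ⊥≡ (unblocked count L)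
    where
    ⊥≡ : ⊥ {b} ++ ⊥ {sum bs} ≡ ⊥
    ⊥≡ = sym (⊥-++ b (sum bs))

  safe-⊆-free : ∀ {bs A E D} (L : Layout bs A E D) → safe L ⊆ free A E
  safe-⊆-free []              = λ ()
  safe-⊆-free (blocked {A₀ = A₀} {E₀} {A} {E} _ L) =
    ⊆-free-++ A₀ E₀ A E (++-⊆ ⊆-refl (safe-⊆-free L))
  safe-⊆-free (unblocked {A₀ = A₀} {E₀} {A} {E} _ L) =
    ⊆-free-++ A₀ E₀ A E (++-⊆ ⊥⊆ (safe-⊆-free L))

  free-count : ∀ {bs A E D} (L : Layout bs A E D) →
               ∣ free A E ∣ + D ≡ ∣ safe L ∣ + unblocked-boxes L * k
  free-count [] = refl
  free-count {D = D} (blocked {A₀ = A₀} {E₀} {A} {E} _ L) = begin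
    ∣ free (A₀ ++ A) (E₀ ++ E) ∣ + D         ≡⟨ cong (_+ D) (∣free-++∣ A₀ E₀ A E) ⟩
    ∣ free A₀ E₀ ∣ + ∣ free A E ∣ + D        ≡⟨ +-assoc ∣ free A₀ E₀ ∣ _ D ⟩
    ∣ free A₀ E₀ ∣ + (∣ free A E ∣ + D)      ≡⟨ cong (∣ free A₀ E₀ ∣ +_) (free-count L) ⟩
    ∣ free A₀ E₀ ∣ + (∣ safe L ∣ + n * k)    ≡⟨ +-assoc ∣ free A₀ E₀ ∣ _ (n * k) ⟨
    ∣ free A₀ E₀ ∣ + ∣ safe L ∣ + n * k      ≡⟨ cong (_+ n * k) (∣++∣ (free A₀ E₀) (safe L)) ⟨
    ∣ free A₀ E₀ ++ safe L ∣ + n * k         ∎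
    where
    open ≡-Reasoning
    n : ℕ
    n = unblocked-boxes L
  free-count (unblocked {b} {D = D} {δ} {A₀} {E₀} {A} {E} count L) = begin
    ∣ free (A₀ ++ A) (E₀ ++ E) ∣ + (δ + D)   ≡⟨ cong (_+ (δ + D)) (∣free-++∣ A₀ E₀ A E) ⟩
    ∣ free A₀ E₀ ∣ + ∣ free A E ∣ + (δ + D)  ≡⟨ interchange ∣ free A₀ E₀ ∣ _ δ D ⟩
    (∣ free A₀ E₀ ∣ + δ) + (∣ free A E ∣ + D) ≡⟨ cong₂ _+_ count (free-count L) ⟩
    k + (∣ safe L ∣ + n * k)                  ≡⟨ x∙yz≈y∙xz k ∣ safe L ∣ (n * k) ⟩
    ∣ safe L ∣ + (k + n * k)                  ≡⟨ cong (_+ (k + n * k)) (∣⊥++∣ b (safe L)) ⟨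
    ∣ ⊥ {b} ++ safe L ∣ + (k + n * k)        ∎
    where
    open ≡-Reasoning
    n : ℕ
    n = unblocked-boxes L

  -- After any Enforcer move the position still has a layout, of no larger
  -- deficit: a box Enforcer enters becomes blocked.
  enforcer-move : ∀ {bs A E D} → Layout bs A E D → (m : Subset (sum bs)) → m ⊆ free A E →
                  ∃[ D' ] D' ≤ D × Layout bs A (E ∪ m) D'
  enforcer-move [] [] _ = 0 , z≤n , []
  enforcer-move (blocked {b} {A₀ = A₀} {E₀} {A} {E} β L) m m⊆ with splitAt b m
  ... | m₀ , m₁ , refl with ⊆-free-++⁻ A₀ E₀ A E m₀ m⊆
  ... | m₀⊆ , m₁⊆ with enforcer-move L m₁ m₁⊆
  ... | D' , D'≤D , L' rewrite ∪-++ E₀ m₀ E m₁ = D' , D'≤D , blocked (blocked-enforcer β) L'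
  enforcer-move (unblocked {b} {δ = δ} {A₀} {E₀} {A} {E} count L) m m⊆ with splitAt b m
  ... | m₀ , m₁ , refl with ⊆-free-++⁻ A₀ E₀ A E m₀ m⊆
  ... | m₀⊆ , m₁⊆ with enforcer-move L m₁ m₁⊆ | ∣ m₀ ∣ ≟ 0
  ... | D' , D'≤D , L' | yes ∣m₀∣≡0 rewrite ∪-++ E₀ m₀ E m₁ =
    δ + D' , +-monoʳ-≤ δ D'≤D ,
    unblocked (trans (cong (_+ δ) (claim-nothing (claim-enforcer m₀⊆) ∣m₀∣≡0)) count) L'
  ... | D' , D'≤D , L' | no ∣m₀∣≢0 rewrite ∪-++ E₀ m₀ E m₁ =
    D' , ≤-trans D'≤D (m≤n+m _ δ) , blocked (block m₀⊆ (n≢0⇒n>0 ∣m₀∣≢0)) L'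

  claim-safe : ∀ {bs A E D} (L : Layout bs A E D) (m : Subset (sum bs)) → m ⊆ safe L →
               Layout bs (A ∪ m) E D
  claim-safe [] [] _ = []
  claim-safe (blocked {b} {A₀ = A₀} {E₀} {A} β L) m m⊆ with splitAt b m
  ... | m₀ , m₁ , refl with ⊆-++⁻ m₀ (free A₀ E₀) m⊆
  ... | m₀⊆ , m₁⊆ rewrite ∪-++ A₀ m₀ A m₁ = blocked (blocked-avoider m₀⊆ β) (claim-safe L m₁ m₁⊆)
  claim-safe (unblocked {b} {δ = δ} {A₀} {E₀} {A} count L) m m⊆ with splitAt b m
  ... | m₀ , m₁ , refl with ⊆-++⁻ m₀ ⊥ m⊆
  ... | m₀⊆⊥ , m₁⊆ rewrite ∪-++ A₀ m₀ A m₁ =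
    unblocked (trans (cong (_+ δ) (claim-nothing (claim-avoider m₀⊆) ∣m₀∣≡0)) count)
              (claim-safe L m₁ m₁⊆)
    where
    m₀⊆ : m₀ ⊆ free A₀ E₀
    m₀⊆ = ⊆-trans m₀⊆⊥ ⊥⊆
    ∣m₀∣≡0 : ∣ m₀ ∣ ≡ 0
    ∣m₀∣≡0 = n≤0⇒n≡0 (subst (∣ m₀ ∣ ≤_) (∣⊥∣≡0 b) (p⊆q⇒∣p∣≤∣q∣ m₀⊆⊥))

  open-box : ∀ {bs A E D} (L : Layout bs A E D) c → c + D < k → 0 < unblocked-boxes L →
             ∃[ m ] m ⊆ free A E × ∣ m ∣ ≡ ∣ safe L ∣ + c × Layout bs (A ∪ m) E (c + D)
  open-box (blocked {A₀ = A₀} {E₀} {A} {E} β L) c c+D<k has-unblocked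
    with open-box L c c+D<k has-unblocked
  ... | m₁ , m₁⊆ , ∣m₁∣ , L' =
    free A₀ E₀ ++ m₁ , ⊆-free-++ A₀ E₀ A E (++-⊆ ⊆-refl m₁⊆) , size ,
    subst (λ X → Layout _ X _ _) (sym (∪-++ A₀ (free A₀ E₀) A m₁))
          (blocked (blocked-avoider ⊆-refl β) L')
    where
    open ≡-Reasoning
    f₀ : ℕ
    f₀ = ∣ free A₀ E₀ ∣
    size : ∣ free A₀ E₀ ++ m₁ ∣ ≡ ∣ free A₀ E₀ ++ safe L ∣ + c
    size = begin
      ∣ free A₀ E₀ ++ m₁ ∣          ≡⟨ ∣++∣ (free A₀ E₀) m₁ ⟩
      f₀ + ∣ m₁ ∣                   ≡⟨ cong (f₀ +_) ∣m₁∣ ⟩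
      f₀ + (∣ safe L ∣ + c)         ≡⟨ +-assoc f₀ _ c ⟨
      f₀ + ∣ safe L ∣ + c           ≡⟨ cong (_+ c) (∣++∣ (free A₀ E₀) (safe L)) ⟨
      ∣ free A₀ E₀ ++ safe L ∣ + c  ∎
  open-box (unblocked {b} {bs} {D} {δ} {A₀} {E₀} {A} {E} count L) c c+D<k _ =
    opened (choose (free A₀ E₀) c c≤f₀)
    where
    f₀ : ℕ
    f₀ = ∣ free A₀ E₀ ∣
    c≤f₀ : c ≤ f₀
    c≤f₀ = +-cancelʳ-≤ δ c f₀ (begin
      c + δ       ≤⟨ +-monoʳ-≤ c (m≤m+n δ D) ⟩
      c + (δ + D) ≤⟨ <⇒≤ c+D<k ⟩
      k           ≡⟨ count ⟨
      f₀ + δ      ∎)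
      where open ≤-Reasoning
    opened : ∃[ m₀ ] m₀ ⊆ free A₀ E₀ × ∣ m₀ ∣ ≡ c →
             ∃[ m ] m ⊆ free (A₀ ++ A) (E₀ ++ E) × ∣ m ∣ ≡ ∣ ⊥ {b} ++ safe L ∣ + c ×
                    Layout (b ∷ bs) ((A₀ ++ A) ∪ m) (E₀ ++ E) (c + (δ + D))
    opened (m₀ , m₀⊆ , ∣m₀∣) =
      m₀ ++ safe L , ⊆-free-++ A₀ E₀ A E (++-⊆ m₀⊆ (safe-⊆-free L)) , size ,
      subst₂ (λ X D' → Layout (b ∷ bs) X (E₀ ++ E) D') (sym (∪-++ A₀ m₀ A (safe L))) (+-assoc c δ D)
             (unblocked {A₀ = A₀ ∪ m₀} {E₀} count' (claim-safe L (safe L) ⊆-refl))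
      where
      open ≡-Reasoning
      f' : ℕ
      f' = ∣ free (A₀ ∪ m₀) E₀ ∣
      size : ∣ m₀ ++ safe L ∣ ≡ ∣ ⊥ {b} ++ safe L ∣ + c
      size = begin
        ∣ m₀ ++ safe L ∣           ≡⟨ ∣++∣ m₀ (safe L) ⟩
        ∣ m₀ ∣ + ∣ safe L ∣        ≡⟨ cong (_+ ∣ safe L ∣) ∣m₀∣ ⟩
        c + ∣ safe L ∣             ≡⟨ +-comm c _ ⟩
        ∣ safe L ∣ + c             ≡⟨ cong (_+ c) (∣⊥++∣ b (safe L)) ⟨
        ∣ ⊥ {b} ++ safe L ∣ + c    ∎
      count' : f' + (c + δ) ≡ k
      count' = begin
        f' + (c + δ)       ≡⟨ +-assoc f' c δ ⟨
        f' + c + δ         ≡⟨ cong (λ x → f' + x + δ) ∣m₀∣ ⟨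
        f' + ∣ m₀ ∣ + δ    ≡⟨ cong (_+ δ) (claim-avoider m₀⊆) ⟩
        f₀ + δ             ≡⟨ count ⟩
        k                  ∎

  -- When no cell is unclaimed and the total deficit is below k, every box is
  -- blocked, so Avoider owns no whole box.
  finished-won : ∀ {bs A E D} → Layout bs A E D → D < k → ∣ free A E ∣ ≡ 0 →
                 All (λ T → ¬ (T ⊆ A)) (boxes bs)
  finished-won [] _ _ = []
  finished-won (blocked {b} {bs} {A₀ = A₀} {E₀} {A} {E} β L) D<k none =
    not-this-box ∷ map⁺ (All.map not-shifted (finished-won L D<k none-later))
    where
    none-later : ∣ free A E ∣ ≡ 0
    none-later = m+n≡0⇒n≡0 ∣ free A₀ E₀ ∣ (trans (sym (∣free-++∣ A₀ E₀ A E)) none)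
    not-this-box : ¬ (⊤ {b} ++ ⊥ {sum bs} ⊆ A₀ ++ A)
    not-this-box box⊆A = blocked-⊤ β (proj₁ (⊆-++⁻ ⊤ A₀ box⊆A))
    not-shifted : ∀ {T} → ¬ (T ⊆ A) → ¬ (⊥ {b} ++ T ⊆ A₀ ++ A)
    not-shifted T⊈A T'⊆A = T⊈A (proj₂ (⊆-++⁻ ⊥ A₀ T'⊆A))
  finished-won (unblocked {D = D} {δ} {A₀} {E₀} {A} {E} count _) δ+D<k none =
    contradiction (subst (_≤ δ + D) δ≡k (m≤m+n δ D)) (<⇒≱ δ+D<k)
    where
    δ≡k : δ ≡ k
    δ≡k = subst (λ f → f + δ ≡ k) none-here count
      where
      none-here : ∣ free A₀ E₀ ∣ ≡ 0
      none-here = m+n≡0⇒m≡0 ∣ free A₀ E₀ ∣ (trans (sym (∣free-++∣ A₀ E₀ A E)) none)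

module MBoxStrategy (p q k r d : ℕ) (0<p : 0 < p) (0<q : 0 < q) (d∣p+q : d ∣ p + q)
                    (d∣k : d ∣ k) (p<d : p < d) (r≤p : r ≤ p) (d≤k : d ≤ k) where

  open Layouts k

  r<k : r < k
  r<k = ≤-<-trans r≤p (<-≤-trans p<d d≤k)

  -- Modulo d, the unclaimed cells number -lag t when it is t's turn.
  lag : Player → ℕ
  lag enforcer = r
  lag avoider  = r + q

  -- Moves of exactly q (resp. p) cells move the residue from one turn's value
  -- to the other's, since d ∣ p + q.
  residue-after-enforcer : ∀ {f f'} → f' + q ≡ f → d ∣ f + r → d ∣ f' + (r + q)
  residue-after-enforcer {f' = f'} refl =
    subst (d ∣_) (trans (+-assoc f' q r) (cong (f' +_) (+-comm q r)))

  residue-after-avoider : ∀ {f f'} → f' + p ≡ f → d ∣ f + (r + q) → d ∣ f' + r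
  residue-after-avoider {f' = f'} refl d∣f+r+q = ∣m+n∣m⇒∣n (subst (d ∣_) regroup d∣f+r+q) d∣p+q
    where
    regroup : f' + p + (r + q) ≡ p + q + (f' + r)
    regroup = trans (interchange f' p r q) (+-comm (f' + r) (p + q))

  Position : (bs : List ℕ) → Player → Subset (sum bs) → Subset (sum bs) → Set
  Position bs t A E = ∃[ D ] D ≤ r × Layout bs A E D × (0 < ∣ free A E ∣ → d ∣ ∣ free A E ∣ + lag t)

  won : ∀ {bs t A E} → Position bs t A E → ∣ free A E ∣ ≡ 0 → All (λ T → ¬ (T ⊆ A)) (boxes bs)
  won (D , D≤r , L , _) none = finished-won L (≤-<-trans D≤r r<k) none

  enforcer-step : ∀ {bs A E} → Position bs enforcer A E → (m : Subset (sum bs)) → m ⊆ free A E →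
                  ∣ m ∣ ≡ q ⊓ ∣ free A E ∣ → Position bs avoider A (E ∪ m)
  enforcer-step {A = A} {E} (D , D≤r , L , residue) m m⊆ ∣m∣ with enforcer-move L m m⊆
  ... | D' , D'≤D , L' = D' , ≤-trans D'≤D D≤r , L' , residue'
    where
    f' : ℕ
    f' = ∣ free A (E ∪ m) ∣
    f : ℕ
    f = ∣ free A E ∣
    claimed : f' + ∣ m ∣ ≡ f
    claimed = claim-enforcer m⊆
    residue' : 0 < f' → d ∣ f' + (r + q)
    residue' 0<f' = residue-after-enforcer claimed-q (residue 0<f)
      where
      claimed-q : f' + q ≡ f
      claimed-q = subst (λ c → f' + c ≡ f) (claim-full ∣m∣ claimed 0<f') claimed
      0<f : 0 < f
      0<f = <-≤-trans 0<f' (subst (f' ≤_) claimed (m≤m+n f' ∣ m ∣))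

  GoodMove : (bs : List ℕ) → Subset (sum bs) → Subset (sum bs) → Set
  GoodMove bs A E = ∃[ m ] m ⊆ free A E × ∣ m ∣ ≡ p ⊓ ∣ free A E ∣ × Position bs enforcer (A ∪ m) E

  claim-p : ∀ {bs A E D} (m : Subset (sum bs)) → m ⊆ free A E → ∣ m ∣ ≡ p → D ≤ r →
            Layout bs (A ∪ m) E D → d ∣ ∣ free A E ∣ + (r + q) → GoodMove bs A E
  claim-p {A = A} {E} m m⊆ ∣m∣≡p D≤r L' residue =
    m , m⊆ , trans ∣m∣≡p (sym (m≤n⇒m⊓n≡m p≤∣free∣)) , _ , D≤r , L' ,
    λ _ → residue-after-avoider claimed residue
    where
    claimed : ∣ free (A ∪ m) E ∣ + p ≡ ∣ free A E ∣
    claimed = subst (λ c → ∣ free (A ∪ m) E ∣ + c ≡ ∣ free A E ∣) ∣m∣≡p (claim-avoider m⊆)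
    p≤∣free∣ : p ≤ ∣ free A E ∣
    p≤∣free∣ = subst (_≤ ∣ free A E ∣) ∣m∣≡p (p⊆q⇒∣p∣≤∣q∣ m⊆)

  safe-move : ∀ {bs A E D} (L : Layout bs A E D) → D ≤ r → p ≤ ∣ safe L ∣ →
              d ∣ ∣ free A E ∣ + (r + q) → GoodMove bs A E
  safe-move L D≤r p≤∣safe∣ residue with choose (safe L) p p≤∣safe∣
  ... | m , m⊆safe , ∣m∣≡p =
    claim-p m (⊆-trans m⊆safe (safe-⊆-free L)) ∣m∣≡p D≤r (claim-safe L m m⊆safe) residue

  last-move : ∀ {bs A E D} (L : Layout bs A E D) → D ≤ r → unblocked-boxes L ≡ 0 →
              ∣ safe L ∣ < p → GoodMove bs A E
  last-move {A = A} {E} {D} L D≤r none-unblocked ∣safe∣<p =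
    safe L , safe-⊆-free L , ∣safe∣≡p⊓f , D , D≤r , claim-safe L (safe L) ⊆-refl ,
    λ 0<f' → contradiction f'≡0 (>⇒≢ 0<f')
    where
    f : ℕ
    f = ∣ free A E ∣
    s : ℕ
    s = ∣ safe L ∣
    f≤s : f ≤ s
    f≤s = begin
      f                              ≤⟨ m≤m+n f D ⟩
      f + D                          ≡⟨ free-count L ⟩
      s + unblocked-boxes L * k      ≡⟨ cong (λ n → s + n * k) none-unblocked ⟩
      s + 0                          ≡⟨ +-identityʳ s ⟩
      s                              ∎
      where open ≤-Reasoning
    f≡s : f ≡ s
    f≡s = ≤-antisym f≤s (p⊆q⇒∣p∣≤∣q∣ (safe-⊆-free L))
    ∣safe∣≡p⊓f : s ≡ p ⊓ f
    ∣safe∣≡p⊓f = trans (sym f≡s) (sym (m≥n⇒m⊓n≡n (subst (_≤ p) (sym f≡s) (<⇒≤ ∣safe∣<p))))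
    f'≡0 : ∣ free (A ∪ safe L) E ∣ ≡ 0
    f'≡0 = +-cancelʳ-≡ s _ 0 (trans (claim-avoider (safe-⊆-free L)) f≡s)

  -- Otherwise the residue condition forces ∣ safe ∣ + (r - D) = p, and Avoider
  -- claims all safe cells and r - D cells of an unblocked box.
  opening-move : ∀ {bs A E D} (L : Layout bs A E D) → D ≤ r → 0 < unblocked-boxes L →
                 ∣ safe L ∣ < p → d ∣ ∣ free A E ∣ + (r + q) → GoodMove bs A E
  opening-move {bs} {A} {E} {D} L D≤r has-unblocked ∣safe∣<p residue =
    opened (open-box L c (subst (_< k) (sym c+D≡r) r<k) has-unblocked)
    where
    f : ℕ
    f = ∣ free A E ∣
    s : ℕ
    s = ∣ safe L ∣
    n : ℕ
    n = unblocked-boxes L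
    c : ℕ
    c = r ∸ D
    c+D≡r : c + D ≡ r
    c+D≡r = m∸n+n≡m D≤r
    regroup : n * k + (s + c + q) ≡ f + (r + q)
    regroup = begin
      n * k + (s + c + q)   ≡⟨ shuffle₁ (n * k) s c q ⟩
      (s + n * k) + (c + q) ≡⟨ cong (_+ (c + q)) (free-count L) ⟨
      (f + D) + (c + q)     ≡⟨ shuffle₂ f D c q ⟩
      f + ((c + D) + q)     ≡⟨ cong (λ x → f + (x + q)) c+D≡r ⟩
      f + (r + q)           ∎
      where
      open ≡-Reasoning
      shuffle₁ : ∀ x s c q → x + (s + c + q) ≡ (s + x) + (c + q)
      shuffle₁ = solve-∀
      shuffle₂ : ∀ f D c q → (f + D) + (c + q) ≡ f + ((c + D) + q)
      shuffle₂ = solve-∀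
    s+c≡p : s + c ≡ p
    s+c≡p = congruent-close q (∣m+n∣m⇒∣n (subst (d ∣_) (sym regroup) residue) (∣n⇒∣m*n n d∣k)) d∣p+q
              (+-mono-<-≤ ∣safe∣<p (≤-trans (m∸n≤m r D) (≤-trans r≤p (<⇒≤ p<d))))
              (<-≤-trans p<d (m≤n+m d (s + c)))
    opened : ∃[ m ] m ⊆ free A E × ∣ m ∣ ≡ s + c × Layout bs (A ∪ m) E (c + D) → GoodMove bs A E
    opened (m , m⊆ , ∣m∣ , L') = claim-p m m⊆ (trans ∣m∣ s+c≡p) (≤-reflexive c+D≡r) L' residue

  avoider-step : ∀ {bs A E} → Position bs avoider A E → 0 < ∣ free A E ∣ → GoodMove bs A E
  avoider-step (D , D≤r , L , residue) 0<f with p ≤? ∣ safe L ∣ | unblocked-boxes L in unblocked≡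
  ... | yes p≤∣safe∣ | _     = safe-move L D≤r p≤∣safe∣ (residue 0<f)
  ... | no p≰∣safe∣  | zero  = last-move L D≤r unblocked≡ (≰⇒> p≰∣safe∣)
  ... | no p≰∣safe∣  | suc _ =
    opening-move L D≤r (subst (0 <_) (sym unblocked≡) 0<1+n) (≰⇒> p≰∣safe∣) (residue 0<f)

  initial : ∀ m → Position ((k ∸ r) ∷ replicate m k) enforcer ⊥ ⊥
  initial m = r + 0 , ≤-reflexive (+-identityʳ r) , unblocked-⊥ first (others m) , λ _ → residue₀
    where
    first : ∣ free (⊥ {k ∸ r}) ⊥ ∣ + r ≡ k
    first = trans (cong (_+ r) (∣free-⊥⊥∣ (k ∸ r))) (m∸n+n≡m (<⇒≤ r<k))
    others : ∀ m → Layout (replicate m k) ⊥ ⊥ 0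
    others zero    = []
    others (suc m) = unblocked-⊥ (trans (+-identityʳ _) (∣free-⊥⊥∣ k)) (others m)
    d∣boxes : ∀ m → d ∣ sum (replicate m k)
    d∣boxes zero    = d ∣0
    d∣boxes (suc m) = ∣m∣n⇒∣m+n d∣k (d∣boxes m)
    S : ℕ
    S = sum (replicate m k)
    residue₀ : d ∣ ∣ free (⊥ {k ∸ r + S}) ⊥ ∣ + r
    residue₀ = subst (d ∣_) (sym (begin
      ∣ free (⊥ {k ∸ r + S}) ⊥ ∣ + r ≡⟨ cong (_+ r) (∣free-⊥⊥∣ (k ∸ r + S)) ⟩
      k ∸ r + S + r                  ≡⟨ xy∙z≈xz∙y (k ∸ r) S r ⟩
      k ∸ r + r + S                  ≡⟨ cong (_+ S) (m∸n+n≡m (<⇒≤ r<k)) ⟩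
      k + S                          ∎))
      (∣m∣n⇒∣m+n d∣k (d∣boxes m))
      where open ≡-Reasoning

  mbox-wins : ∀ m → AvoiderWinsMBoxSecond ((k ∸ r) ∷ replicate m k) p q
  mbox-wins m = avoider-wins (initial m)
    where
    bs : List ℕ
    bs = (k ∸ r) ∷ replicate m k
    open FromInvariant p q (boxes bs) 0<p 0<q (Position bs)
                       (λ {t} → won {bs} {t}) (enforcer-step {bs}) (avoider-step {bs})

lemma2p2 : (p q k m r : ℕ) → 0 < p → 0 < q → 0 < k →
    p < gcd (p + q) k → r ≤ p →
    AvoiderWinsMBoxSecond ((k ∸ r) ∷ replicate m k) p q
lemma2p2 p q k m r 0<p 0<q 0<k p<gcd r≤p = mbox-wins m
  where
  d∣k : gcd (p + q) k ∣ k
  d∣k = gcd[m,n]∣n (p + q) k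
  open MBoxStrategy p q k r (gcd (p + q) k) 0<p 0<q (gcd[m,n]∣m (p + q) k) d∣k p<gcd r≤p
                    (∣⇒≤ {{>-nonZero 0<k}} d∣k)
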